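{- Let $G=(V,E)$ and the algorithm be as described in the context. In a stable configuration, $PRfree(i)$ is false for every $i\in V$, where $PRfree(i)\equiv (p_i=null) \text{ and } (\exists j\in N(i): \neg PRmarried(j))$.
   Context: Let $G=(V,E)$ be a finite simple undirected graph; each node is a process and $N(i)$ denotes the set of neighbours of $i$. Each process has an identifier from a totally ordered set; identifiers of any two distinct processes at distance at most $2$ are distinct, and comparisons such as $j>i$ between processes are comparisons of their identifiers. Each process $i$ holds variables $m_i\in\{\text{true},\text{false}\}$ and $p_i\in\{null\}\cup N(i)$; a configuration is an assignment of values to all these variables. Define the predicate $PRmarried(i)\equiv \exists j\in N(i): (p_i=j \text{ and } p_j=i)$. The algorithm consists of the following four guarded rules for each process $i$ (a rule is enabled at $i$ if its guard holds): Update: if $m_i\neq PRmarried(i)$ then $m_i:=PRmarried(i)$. Marriage: if $m_i=PRmarried(i)$ and $p_i=null$ and there is $j\in N(i)$ with $p_j=i$, then $p_i:=j$ (for such a $j$). Seduction: if $m_i=PRmarried(i)$ and $p_i=null$ and $p_k\neq i$ for all $k\in N(i)$ and there is $j\in N(i)$ with $p_j=null$, $j>i$ and $m_j=\text{false}$, then $p_i:=\max\{j\in N(i): p_j=null,\ j>i,\ m_j=\text{false}\}$. Abandonment: if $m_i=PRmarried(i)$ and $p_i=j\neq null$ and $p_j\neq i$ and ($m_j=\text{true}$ or $j\le i$), then $p_i:=null$. A process is eligible if some rule is enabled at it. A configuration is stable if no process is eligible. -}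

module Defs where

open import Level using (Level)
open import Data.Nat using (ℕ)
open import Data.Fin using (Fin)
open import Data.Bool using (Bool; true; false)
open import Data.Maybe using (Maybe; just; nothing)
open import Data.Product using (Σ; ∃; ∃-syntax; _×_; _,_)
open import Data.Sum using (_⊎_)
open import Relation.Nullary using (¬_)
open import Relation.Binary.PropositionalEquality using (_≡_; _≢_)
open import Relation.Binary.Bundles using (StrictTotalOrder)

record Graph (n : ℕ) : Set₁ where
  field
    Adj     : Fin n → Fin n → Set
    sym     : ∀ {i j} → Adj i j → Adj j i
    irrefl  : ∀ {i} → ¬ Adj i i

module Algorithm {n : ℕ} (G : Graph n)
                 {a ℓ₁ ℓ₂ : Level} (O : StrictTotalOrder a ℓ₁ ℓ₂)
                 (ident : Fin n → StrictTotalOrder.Carrier O) where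

  open Graph G
  open StrictTotalOrder O renaming (_<_ to _≺_; _≈_ to _≃_)

  LocallyUnique : Set _
  LocallyUnique =
      (∀ i j → Adj i j → ¬ (ident i ≃ ident j))
    × (∀ i j k → Adj i k → Adj k j → i ≢ j → ¬ (ident i ≃ ident j))

  -- A configuration: m_i ∈ Bool, p_i ∈ {null} ∪ N(i)  (null = nothing)
  record Config : Set where
    field
      m     : Fin n → Bool
      p     : Fin n → Maybe (Fin n)
      p-nbr : ∀ i j → p i ≡ just j → Adj i j

  module _ (c : Config) where
    open Config c

    PRmarried : Fin n → Set
    PRmarried i = ∃[ j ] (Adj i j × p i ≡ just j × p j ≡ just i)

    MOk : Fin n → Set
    MOk i = (m i ≡ true → PRmarried i) × (PRmarried i → m i ≡ true)

    UpdateEnabled : Fin n → Set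
    UpdateEnabled i = ¬ MOk i

    MarriageEnabled : Fin n → Set
    MarriageEnabled i = MOk i × p i ≡ nothing × ∃[ j ] (Adj i j × p j ≡ just i)

    SeductionEnabled : Fin n → Set _
    SeductionEnabled i =
      MOk i × p i ≡ nothing × (∀ k → Adj i k → p k ≢ just i)
      × ∃[ j ] (Adj i j × p j ≡ nothing × ident i ≺ ident j × m j ≡ false)

    -- j ≤ i  is rendered as  (j ≈ i ⊎ j < i)
    AbandonmentEnabled : Fin n → Set _
    AbandonmentEnabled i =
      MOk i × ∃[ j ] (p i ≡ just j × p j ≢ just i
                      × (m j ≡ true ⊎ (ident j ≃ ident i ⊎ ident j ≺ ident i)))

    Eligible : Fin n → Set _
    Eligible i = UpdateEnabled i ⊎ MarriageEnabled i
               ⊎ SeductionEnabled i ⊎ AbandonmentEnabled i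

    Stable : Set _
    Stable = ∀ i → ¬ Eligible i

    PRfree : Fin n → Set
    PRfree i = p i ≡ nothing × ∃[ j ] (Adj i j × ¬ PRmarried j)

-- Let i be free with unmarried neighbour j. If j points at some k without being married to it, stability rules out
-- Abandonment and Marriage, which forces id j < id k and k to be in the same
-- situation; this yields an infinite ascending chain of identifiers in a finite
-- graph. If j points nowhere, i and j are both unpointed, unmarried singles,
-- and the one with the smaller identifier could apply Seduction.
module Submission where

open import Defs
open import Level using (Level)
open import Data.Nat using (ℕ)
open import Data.Fin using (Fin)
open import Data.Fin.Induction using (spo-noetherian)
open import Data.Bool using (true; false)
import Data.Bool.Properties as Bool
open import Data.Bool.Properties using (¬-not)
open import Data.Fin.Properties using (_≟_)
open import Data.Maybe using (just; nothing)
import Data.Maybe.Properties as Maybe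
open import Data.Maybe.Properties using (just-injective)
open import Data.Product using (∃-syntax; _×_; _,_; proj₁; proj₂)
open import Data.Sum using (_⊎_; inj₁; inj₂)
open import Function using (_∘_; _on_; flip)
open import Induction.WellFounded using (Acc; acc)
open import Relation.Nullary using (¬_; Dec; yes; no; contradiction)
open import Relation.Nullary.Decidable using (decidable-stable; _×-dec_; _→-dec_)
open import Relation.Binary.Core using (Rel)
open import Relation.Binary.Structures using (IsStrictPartialOrder)
open import Relation.Binary.Definitions using (tri<; tri≈; tri>)
open import Relation.Binary.PropositionalEquality using (_≡_; _≢_; refl; sym; trans; subst)
open import Relation.Binary.Bundles using (StrictTotalOrder)
import Relation.Binary.Construct.On as On

module _ {n : ℕ} {a ℓ₁ ℓ₂ : Level} {A : Set a} {_≈_ : Rel A ℓ₁} {_<_ : Rel A ℓ₂}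
         (isSPO : IsStrictPartialOrder _≈_ _<_) (f : Fin n → A) where

  ascending-chain-impossible : ∀ {p} (P : Fin n → Set p) →
    (∀ x → P x → ∃[ y ] (f x < f y × P y)) → ∀ x → ¬ P x
  ascending-chain-impossible P step x = go (noetherian x)
    where
    noetherian = spo-noetherian (On.isStrictPartialOrder f isSPO)

    go : ∀ {x} → Acc (flip (_<_ on f)) x → ¬ P x
    go {x} (acc rec) px with step x px
    ... | y , fx<fy , py = go (rec fx<fy) py

module StableConfig {n : ℕ} (G : Graph n) {a ℓ₁ ℓ₂ : Level} (O : StrictTotalOrder a ℓ₁ ℓ₂)
         (ident : Fin n → StrictTotalOrder.Carrier O)
         (c : Algorithm.Config G O ident)
         (stable : Algorithm.Stable G O ident c) where

  open Graph G using (Adj) renaming (sym to Adj-sym)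
  open StrictTotalOrder O using (compare; isStrictPartialOrder)
    renaming (_<_ to _≺_; _≈_ to _≃_)
  open StrictTotalOrder.Eq O using () renaming (sym to ≃-sym)
  open Algorithm G O ident
  open Config c

  Courts : Fin n → Fin n → Set
  Courts j k = p j ≡ just k × p k ≢ just j

  null⇒unmarried : ∀ {i} → p i ≡ nothing → ¬ PRmarried c i
  null⇒unmarried pi (_ , _ , pi′ , _) with trans (sym pi) pi′
  ... | ()

  PRmarried? : ∀ i → Dec (PRmarried c i)
  PRmarried? i = decide (p i) refl
    where
    decide : ∀ x → p i ≡ x → Dec (PRmarried c i)
    decide nothing  pi = no (null⇒unmarried pi)
    decide (just j) pi with Maybe.≡-dec _≟_ (p j) (just i)
    ... | yes pj = yes (j , p-nbr i j pi , pi , pj)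
    ... | no pj≢ = no λ (k , _ , pi′ , pk) →
      pj≢ (subst (λ x → p x ≡ just i) (just-injective (trans (sym pi′) pi)) pk)

  -- A disabled Update rule only gives ¬ ¬ MOk i; decidability removes the double negation.
  mOk : ∀ i → MOk c i
  mOk i = decidable-stable
    ((m i Bool.≟ true →-dec PRmarried? i) ×-dec (PRmarried? i →-dec m i Bool.≟ true))
    (λ ¬ok → stable i (inj₁ ¬ok))

  unmarried⇒m≡false : ∀ {i} → ¬ PRmarried c i → m i ≡ false
  unmarried⇒m≡false {i} ¬married = ¬-not (¬married ∘ proj₁ (mOk i))

  m≡false⇒unmarried : ∀ {i} → m i ≡ false → ¬ PRmarried c i
  m≡false⇒unmarried {i} mi married with trans (sym mi) (proj₂ (mOk i) married)
  ... | ()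

  null⇒unpointed : ∀ {i} → p i ≡ nothing → ∀ k → Adj i k → p k ≢ just i
  null⇒unpointed {i} pi k i~k pk = stable i (inj₂ (inj₁ (mOk i , pi , k , i~k , pk)))

  courts-ascends : ∀ {j k} → Courts j k → ident j ≺ ident k × ∃[ l ] Courts k l
  courts-ascends {j} {k} (pj , pk≢) = j≺k , next (p k) refl
    where
    not-abandoning : ¬ (m k ≡ true ⊎ (ident k ≃ ident j ⊎ ident k ≺ ident j))
    not-abandoning cond = stable j (inj₂ (inj₂ (inj₂ (mOk j , k , pj , pk≢ , cond))))

    mk≡false : m k ≡ false
    mk≡false = ¬-not (not-abandoning ∘ inj₁)

    j≺k : ident j ≺ ident k
    j≺k with compare (ident j) (ident k)
    ... | tri< j≺k _ _ = j≺k
    ... | tri≈ _ j≃k _ = contradiction (inj₂ (inj₁ (≃-sym j≃k))) not-abandoning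
    ... | tri> _ _ k≺j = contradiction (inj₂ (inj₂ k≺j)) not-abandoning

    next : ∀ x → p k ≡ x → ∃[ l ] Courts k l
    next nothing  pk = contradiction pj (null⇒unpointed pk j (Adj-sym (p-nbr j k pj)))
    next (just l) pk =
      l , pk , λ pl → m≡false⇒unmarried mk≡false (l , p-nbr k l pk , pk , pl)

  no-courtship : ∀ j k → ¬ Courts j k
  no-courtship j k courts = ascending-chain-impossible isStrictPartialOrder ident
    (λ x → ∃[ y ] Courts x y)
    (λ _ (y , x-courts-y) → y , courts-ascends x-courts-y)
    j (k , courts)

  unmarried⇒null : ∀ {j} → ¬ PRmarried c j → p j ≡ nothing
  unmarried⇒null {j} ¬married = pointer (p j) refl
    where
    pointer : ∀ x → p j ≡ x → p j ≡ nothing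
    pointer nothing  pj = pj
    pointer (just k) pj =
      contradiction (pj , λ pk → ¬married (k , p-nbr j k pj , pj , pk)) (no-courtship j k)

  no-seduction : ∀ {i j} → Adj i j → p i ≡ nothing → p j ≡ nothing → ¬ ident i ≺ ident j
  no-seduction {i} {j} i~j pi pj i≺j = stable i (inj₂ (inj₂ (inj₁
    (mOk i , pi , null⇒unpointed pi , j , i~j , pj , i≺j , unmarried⇒m≡false (null⇒unmarried pj)))))

  no-free-process : (∀ i j → Adj i j → ¬ ident i ≃ ident j) → ∀ i → ¬ PRfree c i
  no-free-process adjacent-distinct i (pi , j , i~j , ¬married)
    with compare (ident i) (ident j)
  ... | tri< i≺j _ _ = no-seduction i~j pi (unmarried⇒null ¬married) i≺j
  ... | tri≈ _ i≃j _ = adjacent-distinct i j i~j i≃j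
  ... | tri> _ _ j≺i = no-seduction (Adj-sym i~j) (unmarried⇒null ¬married) pi j≺i

lemma4 : {n : ℕ} (G : Graph n) {a ℓ₁ ℓ₂ : Level} (O : StrictTotalOrder a ℓ₁ ℓ₂)
         (ident : Fin n → StrictTotalOrder.Carrier O) →
         Algorithm.LocallyUnique G O ident →
         (c : Algorithm.Config G O ident) →
         Algorithm.Stable G O ident c →
         ∀ i → ¬ Algorithm.PRfree G O ident c i
lemma4 G O ident (adjacent-distinct , _) c stable =
  StableConfig.no-free-process G O ident c stable adjacent-distinct
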